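{- Let $f=x^2+y^2$, let $p$ be a prime with $p\equiv 3\pmod 4$, and let $n\geq 2$. Then $N_{p^2}=\{jp: 0<j<p\}$ and $N_{p^3}=\varnothing$; moreover \[\alpha(p^n)=\begin{cases}p\,\alpha(p^{n-1}), & \text{if } n \text{ is odd},\\ p\,\alpha(p^{n-1})-p+1, & \text{if } n \text{ is even},\end{cases}\] and \[\alpha(p^n)=\begin{cases}\frac{p}{p+1}(p^n+1), & \text{if } n \text{ is odd},\\ \frac{1}{p+1}(p^{n+1}+1), & \text{if } n \text{ is even}.\end{cases}\]
   Context: For a positive integer $n$, $I_n=\{0,1,\ldots,n-1\}$, $A_n$ is the set of $a\in I_n$ such that $x^2+y^2\equiv a\pmod n$ has an integer solution, and $\alpha(n)=|A_n|$. For $m\mid n$, $A_n(m)=\{a+jm: a\in A_m,\ 0\leq j<n/m\}$, and for $n\geq 1$, $N_{p^n}=A_{p^n}(p^{n-1})\setminus A_{p^n}$. -}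

module Defs where

open import Data.Nat using (ℕ; zero; suc; _+_; _*_; _∸_; _^_; _<_; _≤_)
open import Data.Integer as ℤ using (ℤ; +_)
open import Data.Integer.Divisibility as ℤD using ()
open import Data.Product using (Σ; ∃; ∃-syntax; _×_; _,_)
open import Data.List using (List; length)
open import Data.List.Relation.Unary.Unique.Propositional using (Unique)
open import Data.List.Membership.Propositional using (_∈_)
open import Relation.Nullary using (¬_)
open import Relation.Binary.PropositionalEquality using (_≡_)
open import Function.Bundles using (_⇔_)

A : ℕ → ℕ → Set
A n a = a < n × ∃[ x ] ∃[ y ] ((+ n) ℤD.∣ ((x ℤ.* x ℤ.+ y ℤ.* y) ℤ.- (+ a)))

-- b ∈ A_{m*k}(m) = { a + j m : a ∈ A_m , 0 ≤ j < k }   (here k = n/m, n = m*k)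
Lift : (m k : ℕ) → ℕ → Set
Lift m k b = ∃[ a ] ∃[ j ] (A m a × j < k × b ≡ a + j * m)

-- N_{p^n} = A_{p^n}(p^{n-1}) \ A_{p^n}   (meaningful for n ≥ 1; p^n / p^(n-1) = p)
N : (p n : ℕ) → ℕ → Set
N p n b = Lift (p ^ (n ∸ 1)) p b × ¬ A (p ^ n) b

HasCard : (ℕ → Set) → ℕ → Set
HasCard P k = ∃[ xs ] (Unique xs × (∀ a → (a ∈ xs) ⇔ P a) × length xs ≡ k)

α≡ : ℕ → ℕ → Set
α≡ n k = HasCard (A n) k

module Submission where

-- Everything
-- rests on one structural fact (A-split): for every n,
--   A_{p^(n+2)} = {a < p^(n+2) : p ∤ a}  ⊎  {b·p² : b ∈ A_{pⁿ}},
-- together with A_1 = {0} and A_p = {0, …, p − 1}.  Its ingredients are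
--   * modulo an odd prime every residue is a sum of two squares (pigeonhole),
--     and residues prime to p stay sums of two squares modulo every power of p
--     (Hensel's lemma);
--   * for p ≡ 3 (mod 4), p ∣ x² + y² forces p ∣ x and p ∣ y (Thue's lemma plus
--     the fact that a sum of two squares is never ≡ 3 (mod 4)); this gives the
--     descent from A_{p^(n+2)} ∩ pℕ to p²·A_{pⁿ}.
-- Counting both parts with a small theory of finite cardinalities (HasCard)
-- shows α(pⁿ) = alpha p n for an explicit recursion, whose closed form and
-- consecutive-term relations are pure arithmetic.  N_{p²} and N_{p³} are read
-- off A-split directly.

open import Defs
open import Data.Nat using (ℕ; zero; suc; _+_; _*_; _∸_; _^_; _<_; _≤_; _%_; _/_; z≤n; s≤s; NonZero;
  >-nonZero; ≢-nonZero⁻¹; nonTrivial⇒≢1; _<?_; _≤?_; _≟_)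
open import Data.Nat.Properties
import Data.Nat.Tactic.RingSolver as ℕ-Ring
open import Data.Nat.Divisibility using (_∣_; divides; _∣?_; >⇒∤; ∣⇒≤; m∣m*n; ∣n⇒∣m*n; ∣m+n∣m⇒∣n)
open import Data.Nat.DivMod using (m≡m%n+[m/n]*n; m%n<n; m<n*o⇒m/o<n; %-distribˡ-*; %-distribˡ-+)
open import Data.Nat.Primality using (Prime; euclidsLemma; prime⇒irreducible; prime⇒nonZero; prime⇒nonTrivial)
open import Data.Nat.Coprimality using (Coprime; coprime-Bézout)
open import Data.Nat.GCD using (module Bézout)
open import Data.Integer as ℤ using (ℤ; +_; -[1+_]; +[1+_]; ∣_∣)
  renaming (_+_ to _+ᶻ_; _*_ to _*ᶻ_; _-_ to _-ᶻ_; -_ to -ᶻ_)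
import Data.Integer.Properties as ℤ
open import Data.Integer.Divisibility.Signed as ℤ∣ using (divides) renaming (_∣_ to _∣ᶻ_)
open import Data.Integer.DivMod using (_%ℕ_; _/ℕ_; a≡a%ℕn+[a/ℕn]*n; n%ℕd<d)
open import Data.Integer.Tactic.RingSolver using (solve-∀)
open import Data.Fin using (toℕ; fromℕ<)
open import Data.Fin.Properties using (pigeonhole; toℕ-fromℕ<; toℕ<n)
open import Data.List using ([]; _∷_; length; upTo; map; _++_; filter)
import Data.List.Relation.Unary.Unique.Propositional.Properties as Unique
import Data.List.Membership.Propositional.Properties as ∈
open import Data.List.Membership.Propositional.Properties.WithK using (unique∧set⇒bag)
open import Data.List.Relation.Binary.BagAndSetEquality using (∼bag⇒↭)
open import Data.List.Relation.Binary.Permutation.Propositional.Properties using (↭-length)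
open import Data.List.Properties using (length-upTo; length-map; length-++)
open import Data.Product as Product using (∃-syntax; _×_; _,_; proj₁; proj₂)
open import Data.Sum as Sum using (_⊎_; inj₁; inj₂; [_,_])
open import Data.Empty using (⊥; ⊥-elim)
open import Function using (_∘_)
open import Function.Bundles using (_⇔_; mk⇔; Equivalence)
import Function.Properties.Equivalence as ⇔
open import Relation.Nullary using (¬_; yes; no; ¬?)
open import Relation.Unary using (Decidable)
open import Relation.Binary.PropositionalEquality
  using (_≡_; _≢_; refl; sym; trans; cong; cong₂; subst; subst₂; module ≡-Reasoning)

open Equivalence using (to; from)

private variable
  P Q : ℕ → Set
  k l p s : ℕ

-- Two duplicate-free enumerations of the same predicate are permutations
-- of each other, so the cardinality of a predicate is well defined.
card-unique : HasCard P k → HasCard P l → k ≡ l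
card-unique (xs , xs! , xs↔ , refl) (ys , ys! , ys↔ , refl) =
  ↭-length (∼bag⇒↭ (unique∧set⇒bag xs! ys! (λ {a} →
    mk⇔ (λ a∈xs → from (ys↔ a) (to (xs↔ a) a∈xs))
        (λ a∈ys → from (xs↔ a) (to (ys↔ a) a∈ys)))))

card-resp : (∀ a → P a ⇔ Q a) → HasCard P k → HasCard Q k
card-resp P⇔Q (xs , xs! , xs↔ , len) =
  xs , xs! , (λ a → mk⇔ (λ a∈xs → to (P⇔Q a) (to (xs↔ a) a∈xs))
                        (λ q → from (xs↔ a) (from (P⇔Q a) q))) , len

card-range : ∀ n → HasCard (_< n) n
card-range n = upTo n , Unique.upTo⁺ n , (λ a → mk⇔ ∈.∈-upTo⁻ ∈.∈-upTo⁺) , length-upTo n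

card-union : HasCard P k → HasCard Q l → (∀ a → P a → Q a → ⊥) → HasCard (λ a → P a ⊎ Q a) (k + l)
card-union (xs , xs! , xs↔ , refl) (ys , ys! , ys↔ , refl) disjoint =
  xs ++ ys ,
  Unique.++⁺ xs! ys! (λ (a∈xs , a∈ys) → disjoint _ (to (xs↔ _) a∈xs) (to (ys↔ _) a∈ys)) ,
  (λ a → mk⇔ (λ a∈xs++ys → [ inj₁ ∘ to (xs↔ a) , inj₂ ∘ to (ys↔ a) ] (∈.∈-++⁻ xs a∈xs++ys))
             [ ∈.∈-++⁺ˡ ∘ from (xs↔ a) , ∈.∈-++⁺ʳ xs ∘ from (ys↔ a) ]) ,
  length-++ xs

card-image : (g : ℕ → ℕ) → (∀ {x y} → g x ≡ g y → x ≡ y) →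
             HasCard P k → HasCard (λ b → ∃[ a ] (P a × b ≡ g a)) k
card-image g g-injective (xs , xs! , xs↔ , len) =
  map g xs , Unique.map⁺ g-injective xs! ,
  (λ b → mk⇔ (λ b∈gxs → let (a , a∈xs , b≡ga) = ∈.∈-map⁻ g b∈gxs in a , to (xs↔ a) a∈xs , b≡ga)
             (λ { (a , Pa , refl) → ∈.∈-map⁺ g (from (xs↔ a) Pa) })) ,
  trans (length-map g xs) len

length-filter-split : (Q? : Decidable Q) → ∀ xs →
  length (filter Q? xs) + length (filter (¬? ∘ Q?) xs) ≡ length xs
length-filter-split Q? [] = refl
length-filter-split Q? (x ∷ xs) with Q? x
... | yes _ = cong suc (length-filter-split Q? xs)
... | no _ = trans (+-suc _ _) (cong suc (length-filter-split Q? xs))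

card-split : Decidable Q → HasCard P k →
  ∃[ l ] ∃[ m ] (HasCard (λ a → P a × Q a) l × HasCard (λ a → P a × ¬ Q a) m × l + m ≡ k)
card-split {Q = Q} {P = P} Q? (xs , xs! , xs↔ , refl) =
  _ , _ , restrict Q? , restrict (¬? ∘ Q?) , length-filter-split Q? xs
  where
  restrict : {R : ℕ → Set} (R? : Decidable R) → HasCard (λ a → P a × R a) (length (filter R? xs))
  restrict R? = filter R? xs , Unique.filter⁺ R? xs! ,
    (λ a → mk⇔ (λ a∈ → let (a∈xs , Ra) = ∈.∈-filter⁻ R? a∈ in to (xs↔ a) a∈xs , Ra)
               (λ (Pa , Ra) → ∈.∈-filter⁺ R? (from (xs↔ a) Pa) Ra)) ,
    refl

card-multiples : ∀ k N .{{_ : NonZero k}} → HasCard (λ a → a < k * N × k ∣ a) N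
card-multiples k N =
  card-resp multiple⇔ (card-image (_* k) (λ {x} {y} → *-cancelʳ-≡ x y k) (card-range N))
  where
  multiple⇔ : ∀ a → (∃[ b ] (b < N × a ≡ b * k)) ⇔ (a < k * N × k ∣ a)
  multiple⇔ a = mk⇔
    (λ { (b , b<N , refl) → subst (b * k <_) (*-comm N k) (*-monoˡ-< k b<N) , divides b refl })
    (λ { (a<kN , divides b refl) → b , *-cancelʳ-< k b N (subst (b * k <_) (*-comm k N) a<kN) , refl })

card-non-multiples : ∀ k N .{{_ : NonZero k}} → HasCard (λ a → a < k * N × ¬ k ∣ a) ((k ∸ 1) * N)
card-non-multiples k N with card-split (k ∣?_) (card-range (k * N))
... | l , m , multiples , non-multiples , l+m≡kN = subst (HasCard _) m≡ non-multiples
  where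
  l≡N : l ≡ N
  l≡N = card-unique multiples (card-multiples k N)
  m≡ : m ≡ (k ∸ 1) * N
  m≡ = begin
    m                 ≡⟨ m+n∸m≡n l m ⟨
    l + m ∸ l         ≡⟨ cong₂ _∸_ l+m≡kN l≡N ⟩
    k * N ∸ N         ≡⟨ cong (k * N ∸_) (*-identityˡ N) ⟨
    k * N ∸ 1 * N     ≡⟨ *-distribʳ-∸ N k 1 ⟨
    (k ∸ 1) * N       ∎
    where open ≡-Reasoning

SumOfTwoSquaresMod : ℕ → ℤ → Set
SumOfTwoSquaresMod n a = ∃[ x ] ∃[ y ] (+ n ∣ᶻ (x *ᶻ x +ᶻ y *ᶻ y -ᶻ a))

euclidᶻ : Prime p → ∀ a b → + p ∣ᶻ (a *ᶻ b) → + p ∣ᶻ a ⊎ + p ∣ᶻ b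
euclidᶻ p-prime a b p∣ab = Sum.map ℤ∣.∣ᵤ⇒∣ ℤ∣.∣ᵤ⇒∣
  (euclidsLemma ∣ a ∣ ∣ b ∣ p-prime (subst (_ ∣_) (ℤ.abs-* a b) (ℤ∣.∣⇒∣ᵤ p∣ab)))

equal-remainders : ∀ n .{{_ : NonZero n}} x y → x %ℕ n ≡ y %ℕ n → + n ∣ᶻ (x -ᶻ y)
equal-remainders n x y same = divides (x /ℕ n -ᶻ y /ℕ n) (begin
  x -ᶻ y                                  ≡⟨ cong₂ _-ᶻ_ (a≡a%ℕn+[a/ℕn]*n x n) (a≡a%ℕn+[a/ℕn]*n y n) ⟩
  (r +ᶻ x /ℕ n *ᶻ + n) -ᶻ (r′ +ᶻ y /ℕ n *ᶻ + n) ≡⟨ cong (λ t → (r +ᶻ x /ℕ n *ᶻ + n) -ᶻ (t +ᶻ y /ℕ n *ᶻ + n)) (cong +_ (sym same)) ⟩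
  (r +ᶻ x /ℕ n *ᶻ + n) -ᶻ (r +ᶻ y /ℕ n *ᶻ + n) ≡⟨ cancel (r) (x /ℕ n) (y /ℕ n) (+ n) ⟩
  (x /ℕ n -ᶻ y /ℕ n) *ᶻ + n               ∎)
  where
  open ≡-Reasoning
  r r′ : ℤ
  r = + (x %ℕ n)
  r′ = + (y %ℕ n)
  cancel : ∀ r a b n → (r +ᶻ a *ᶻ n) -ᶻ (r +ᶻ b *ᶻ n) ≡ (a -ᶻ b) *ᶻ n
  cancel = solve-∀

pigeonhole-mod : ∀ p .{{_ : NonZero p}} {n} → p < n → (f : ℕ → ℤ) →
                 ∃[ i ] ∃[ j ] (i < j × j < n × + p ∣ᶻ (f i -ᶻ f j))
pigeonhole-mod p p<n f with pigeonhole p<n (λ i → fromℕ< (n%ℕd<d (f (toℕ i)) p))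
... | i , j , i<j , same-residue = toℕ i , toℕ j , i<j , toℕ<n j ,
  equal-remainders p (f (toℕ i)) (f (toℕ j)) (begin
    f (toℕ i) %ℕ p                            ≡⟨ toℕ-fromℕ< _ ⟨
    toℕ (fromℕ< (n%ℕd<d (f (toℕ i)) p))        ≡⟨ cong toℕ same-residue ⟩
    toℕ (fromℕ< (n%ℕd<d (f (toℕ j)) p))        ≡⟨ toℕ-fromℕ< _ ⟩
    f (toℕ j) %ℕ p                            ∎)
  where open ≡-Reasoning

difference-of-squares : ∀ {u v} → u ≤ v → + v *ᶻ + v -ᶻ + u *ᶻ + u ≡ + (v ∸ u) *ᶻ + (v + u)
difference-of-squares {u} {v} u≤v = begin
  + v *ᶻ + v -ᶻ + u *ᶻ + u               ≡⟨ cong (λ w → w *ᶻ w -ᶻ + u *ᶻ + u) v≡d+u ⟩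
  (d +ᶻ + u) *ᶻ (d +ᶻ + u) -ᶻ + u *ᶻ + u   ≡⟨ factor d (+ u) ⟩
  d *ᶻ ((d +ᶻ + u) +ᶻ + u)                ≡⟨ cong (λ w → d *ᶻ (w +ᶻ + u)) v≡d+u ⟨
  d *ᶻ (+ v +ᶻ + u)                        ≡⟨ cong (d *ᶻ_) (ℤ.pos-+ v u) ⟨
  d *ᶻ + (v + u)                           ∎
  where
  open ≡-Reasoning
  d : ℤ
  d = + (v ∸ u)
  v≡d+u : + v ≡ d +ᶻ + u
  v≡d+u = trans (cong +_ (sym (m∸n+n≡m u≤v))) (ℤ.pos-+ (v ∸ u) u)
  factor : ∀ d u → (d +ᶻ u) *ᶻ (d +ᶻ u) -ᶻ u *ᶻ u ≡ d *ᶻ ((d +ᶻ u) +ᶻ u)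
  factor = solve-∀

distinct-squares : Prime p → ∀ {u v} → u < v → u + v < p → ¬ + p ∣ᶻ (+ v *ᶻ + v -ᶻ + u *ᶻ + u)
distinct-squares {p} p-prime {u} {v} u<v u+v<p p∣v²-u²
  with euclidᶻ p-prime (+ (v ∸ u)) (+ (v + u)) (subst (+ p ∣ᶻ_) (difference-of-squares (<⇒≤ u<v)) p∣v²-u²)
... | inj₁ p∣v-u = >⇒∤ {{>-nonZero (m<n⇒0<n∸m u<v)}} v-u<p (ℤ∣.∣⇒∣ᵤ p∣v-u)
  where
  v-u<p : v ∸ u < p
  v-u<p = ≤-<-trans (m∸n≤m v u) (≤-<-trans (m≤n+m v u) u+v<p)
... | inj₂ p∣v+u = >⇒∤ {{>-nonZero (<-≤-trans (s≤s z≤n) (≤-trans u<v (m≤m+n v u)))}} v+u<p (ℤ∣.∣⇒∣ᵤ p∣v+u)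
  where
  v+u<p : v + u < p
  v+u<p = subst (_< p) (+-comm u v) u+v<p

sum-below-half : ∀ {i j h} → i < j → j < h → suc p ≡ h + h → i + j < p
sum-below-half {p} {i} {j} {h} i<j j<h p+1≡2h = ≤-pred (begin
  suc (suc (i + j))  ≡⟨ cong suc (+-suc i j) ⟨
  suc i + suc j      ≤⟨ +-mono-≤ (≤-trans i<j (<⇒≤ j<h)) j<h ⟩
  h + h              ≡⟨ p+1≡2h ⟨
  suc p              ∎)
  where open ≤-Reasoning

-- Modulo an odd prime p = 2h − 1 every integer is a sum of two squares:
-- the h squares i² (i < h) and the h numbers a − k² (k < h) are pairwise
-- incongruent within each family, so by pigeonhole some i² ≡ a − k².
every-residue-sum-of-two-squares : Prime p → ∀ {h} → suc p ≡ h + h → ∀ a → SumOfTwoSquaresMod p a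
every-residue-sum-of-two-squares {p} p-prime {h} p+1≡2h a =
  collision (pigeonhole-mod p {{prime⇒nonZero p-prime}} (≤-reflexive p+1≡2h) candidate)
  where
  candidate : ℕ → ℤ
  candidate i with i <? h
  ... | yes _ = + i *ᶻ + i
  ... | no _ = a -ᶻ + (i ∸ h) *ᶻ + (i ∸ h)

  swap-difference : ∀ x y → -ᶻ (x *ᶻ x -ᶻ y *ᶻ y) ≡ y *ᶻ y -ᶻ x *ᶻ x
  swap-difference = solve-∀
  cross-difference : ∀ x y a → x *ᶻ x -ᶻ (a -ᶻ y *ᶻ y) ≡ x *ᶻ x +ᶻ y *ᶻ y -ᶻ a
  cross-difference = solve-∀
  shifted-difference : ∀ x y a → (a -ᶻ x *ᶻ x) -ᶻ (a -ᶻ y *ᶻ y) ≡ y *ᶻ y -ᶻ x *ᶻ x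
  shifted-difference = solve-∀

  collision : ∃[ i ] ∃[ j ] (i < j × j < h + h × + p ∣ᶻ (candidate i -ᶻ candidate j)) →
              SumOfTwoSquaresMod p a
  collision (i , j , i<j , j<2h , p∣) with i <? h | j <? h
  ... | yes _ | yes j<h = ⊥-elim (distinct-squares p-prime i<j (sum-below-half i<j j<h p+1≡2h)
                             (subst (+ p ∣ᶻ_) (swap-difference (+ i) (+ j)) (ℤ∣.∣m⇒∣-m p∣)))
  ... | yes _ | no _ = + i , + (j ∸ h) , subst (+ p ∣ᶻ_) (cross-difference (+ i) (+ (j ∸ h)) a) p∣
  ... | no i≮h | yes j<h = ⊥-elim (i≮h (<-trans i<j j<h))
  ... | no i≮h | no j≮h = ⊥-elim (distinct-squares p-prime k<l (sum-below-half k<l l<h p+1≡2h)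
                             (subst (+ p ∣ᶻ_) (shifted-difference (+ (i ∸ h)) (+ (j ∸ h)) a) p∣))
    where
    k<l : i ∸ h < j ∸ h
    k<l = ∸-monoˡ-< i<j (≮⇒≥ i≮h)
    l<h : j ∸ h < h
    l<h = subst (j ∸ h <_) (m+n∸m≡n h h) (∸-monoˡ-< j<2h (≮⇒≥ j≮h))

integer-sqrt : ∀ n → ∃[ s ] (s * s ≤ n × n < suc s * suc s)
integer-sqrt zero = 0 , z≤n , s≤s z≤n
integer-sqrt (suc n) with integer-sqrt n
... | s , s²≤n , n<S² with suc s * suc s ≤? suc n
...   | yes S²≤1+n = suc s , S²≤1+n , ≤-<-trans n<S² (*-mono-< (n<1+n (suc s)) (n<1+n (suc s)))
...   | no S²≰1+n = s , m≤n⇒m≤1+n s²≤n , ≰⇒> S²≰1+n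

prime-not-square : Prime p → s * s ≢ p
prime-not-square {p} {s} p-prime s²≡p =
  nonTrivial⇒≢1 {{prime⇒nonTrivial p-prime}} (p≡1 (prime⇒irreducible p-prime (divides s (sym s²≡p))))
  where
  p≡1 : s ≡ 1 ⊎ s ≡ p → p ≡ 1
  p≡1 (inj₁ refl) = sym s²≡p
  p≡1 (inj₂ refl) = *-cancelʳ-≡ p 1 p {{prime⇒nonZero p-prime}} (trans s²≡p (sym (*-identityˡ p)))

∣difference∣≤ : ∀ {u v} → u ≤ s → v ≤ s → ∣ + u -ᶻ + v ∣ ≤ s
∣difference∣≤ {u = u} {v} u≤s v≤s =
  subst (_≤ _) (cong ∣_∣ (sym (ℤ.[+m]-[+n]≡m⊖n u v))) (≤-trans (ℤ.∣m⊝n∣≤m⊔n u v) (⊔-lub u≤s v≤s))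

-- The (s + 1)² numbers
-- u·y − v·x (u, v ≤ s) cannot be pairwise incongruent modulo p.
thue : ∀ p s .{{_ : NonZero p}} → p < suc s * suc s → ∀ x y →
  ∃[ A ] ∃[ B ] (∣ A ∣ ≤ s × ∣ B ∣ ≤ s × ¬ (A ≡ + 0 × B ≡ + 0) × + p ∣ᶻ (A *ᶻ y -ᶻ B *ᶻ x))
thue p s p<S² x y = from-collision (pigeonhole-mod p p<S² combination)
  where
  S = suc s

  -- an index i < S² stands for the pair (i / S, i % S) of numbers ≤ s
  combination : ℕ → ℤ
  combination i = + (i / S) *ᶻ y -ᶻ + (i % S) *ᶻ x

  quotient≤ : ∀ {i} → i < S * S → i / S ≤ s
  quotient≤ {i} i<S² = ≤-pred (m<n*o⇒m/o<n {i} {S} {S} i<S²)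
  remainder≤ : ∀ i → i % S ≤ s
  remainder≤ i = ≤-pred (m%n<n i S)

  rearrange : ∀ u u′ v v′ x y → (u *ᶻ y -ᶻ v *ᶻ x) -ᶻ (u′ *ᶻ y -ᶻ v′ *ᶻ x) ≡ (u -ᶻ u′) *ᶻ y -ᶻ (v -ᶻ v′) *ᶻ x
  rearrange = solve-∀

  ℕ-difference≡0 : ∀ {m n} → + m -ᶻ + n ≡ + 0 → m ≡ n
  ℕ-difference≡0 {m} {n} eq = ℤ.+-injective (ℤ.i-j≡0⇒i≡j (+ m) (+ n) eq)

  from-collision : ∃[ i ] ∃[ j ] (i < j × j < S * S × + p ∣ᶻ (combination i -ᶻ combination j)) →
    ∃[ A ] ∃[ B ] (∣ A ∣ ≤ s × ∣ B ∣ ≤ s × ¬ (A ≡ + 0 × B ≡ + 0) × + p ∣ᶻ (A *ᶻ y -ᶻ B *ᶻ x))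
  from-collision (i , j , i<j , j<S² , p∣) =
    + (i / S) -ᶻ + (j / S) , + (i % S) -ᶻ + (j % S) ,
    ∣difference∣≤ (quotient≤ (<-trans i<j j<S²)) (quotient≤ j<S²) ,
    ∣difference∣≤ (remainder≤ i) (remainder≤ j) ,
    (λ (A≡0 , B≡0) → <-irrefl (same-index (ℕ-difference≡0 A≡0) (ℕ-difference≡0 B≡0)) i<j) ,
    subst (+ p ∣ᶻ_) (rearrange (+ (i / S)) (+ (j / S)) (+ (i % S)) (+ (j % S)) x y) p∣
    where
    same-index : i / S ≡ j / S → i % S ≡ j % S → i ≡ j
    same-index q≡ r≡ = begin
      i                   ≡⟨ m≡m%n+[m/n]*n i S ⟩
      i % S + i / S * S   ≡⟨ cong₂ (λ r q → r + q * S) r≡ q≡ ⟩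
      j % S + j / S * S   ≡⟨ m≡m%n+[m/n]*n j S ⟨
      j                   ∎
      where open ≡-Reasoning

square-mod4 : ∀ n → n * n % 4 ≡ 0 ⊎ n * n % 4 ≡ 1
square-mod4 n = subst (λ t → t ≡ 0 ⊎ t ≡ 1) (sym (%-distribˡ-* n n 4)) (residue (n % 4) (m%n<n n 4))
  where
  residue : ∀ r → r < 4 → r * r % 4 ≡ 0 ⊎ r * r % 4 ≡ 1
  residue 0 _ = inj₁ refl
  residue 1 _ = inj₂ refl
  residue 2 _ = inj₁ refl
  residue 3 _ = inj₂ refl
  residue (suc (suc (suc (suc _)))) (s≤s (s≤s (s≤s (s≤s ()))))

sum-of-two-squares-mod4 : ∀ a b → (a * a + b * b) % 4 ≢ 3
sum-of-two-squares-mod4 a b ≡3 =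
  impossible (square-mod4 a) (square-mod4 b) (trans (sym (%-distribˡ-+ (a * a) (b * b) 4)) ≡3)
  where
  impossible : ∀ {u v} → u ≡ 0 ⊎ u ≡ 1 → v ≡ 0 ⊎ v ≡ 1 → (u + v) % 4 ≢ 3
  impossible (inj₁ refl) (inj₁ refl) ()
  impossible (inj₁ refl) (inj₂ refl) ()
  impossible (inj₂ refl) (inj₁ refl) ()
  impossible (inj₂ refl) (inj₂ refl) ()

square-abs : ∀ i → i *ᶻ i ≡ + (∣ i ∣ * ∣ i ∣)
square-abs (+ zero) = refl
square-abs +[1+ n ] = refl
square-abs -[1+ n ] = refl

multiple-below-double : ∀ {n} → p ∣ n → 0 < n → n < p + p → n ≡ p
multiple-below-double {p} (divides 1 refl) _ _ = +-identityʳ p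
multiple-below-double {p} (divides (suc (suc q)) refl) _ n<2p =
  ⊥-elim (≤⇒≯ (+-monoʳ-≤ p (m≤m+n p (q * p))) n<2p)

-- If p ≡ 3 (mod 4) and a, b ≤ s with s² < p, then p ∣ a² + b² only when
-- a = b = 0: otherwise 0 < a² + b² < 2p would force a² + b² = p ≡ 3 (mod 4).
small-sum-of-squares : p % 4 ≡ 3 → s * s < p → ∀ {a b} → a ≤ s → b ≤ s →
                       p ∣ a * a + b * b → a ≡ 0 × b ≡ 0
small-sum-of-squares {p} p≡3 s²<p {a} {b} a≤s b≤s p∣a²+b² with a * a + b * b ≟ 0
... | yes a²+b²≡0 = square≡0 (m+n≡0⇒m≡0 _ a²+b²≡0) , square≡0 (m+n≡0⇒n≡0 _ a²+b²≡0)
  where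
  square≡0 : ∀ {n} → n * n ≡ 0 → n ≡ 0
  square≡0 {zero} _ = refl
... | no a²+b²≢0 =
  ⊥-elim (sum-of-two-squares-mod4 a b (trans (cong (_% 4) a²+b²≡p) p≡3))
  where
  a²+b²<2p : a * a + b * b < p + p
  a²+b²<2p = +-mono-< (≤-<-trans (*-mono-≤ a≤s a≤s) s²<p) (≤-<-trans (*-mono-≤ b≤s b≤s) s²<p)
  a²+b²≡p : a * a + b * b ≡ p
  a²+b²≡p = multiple-below-double p∣a²+b² (n≢0⇒n>0 a²+b²≢0) a²+b²<2p

-- Otherwise Thue's lemma
-- with s = ⌊√p⌋ gives small A, B with A·y ≡ B·x; then
--   (A² + B²)·y² = (A·y − B·x)(A·y + B·x) + B²·(x² + y²) ≡ 0 (mod p),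
-- so p ∣ A² + B², contradicting small-sum-of-squares.
prime-3mod4-∣-sum-of-squares : Prime p → p % 4 ≡ 3 → ∀ x y → + p ∣ᶻ (x *ᶻ x +ᶻ y *ᶻ y) → + p ∣ᶻ y
prime-3mod4-∣-sum-of-squares {p} p-prime p≡3 x y p∣x²+y² with + p ℤ∣.∣? y
... | yes p∣y = p∣y
... | no p∤y with integer-sqrt p
...   | s , s²≤p , p<S² with thue p s {{prime⇒nonZero p-prime}} p<S² x y
...     | A , B , ∣A∣≤s , ∣B∣≤s , not-both-0 , p∣Ay-Bx =
  ⊥-elim (not-both-0 (Product.map ℤ.∣i∣≡0⇒i≡0 ℤ.∣i∣≡0⇒i≡0
    (small-sum-of-squares p≡3 s²<p ∣A∣≤s ∣B∣≤s p∣∣A∣²+∣B∣²)))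
  where
  s²<p : s * s < p
  s²<p = ≤∧≢⇒< s²≤p (prime-not-square {s = s} p-prime)

  key-identity : ∀ A B x y → (A *ᶻ A +ᶻ B *ᶻ B) *ᶻ (y *ᶻ y) ≡
                 (A *ᶻ y -ᶻ B *ᶻ x) *ᶻ (A *ᶻ y +ᶻ B *ᶻ x) +ᶻ B *ᶻ B *ᶻ (x *ᶻ x +ᶻ y *ᶻ y)
  key-identity = solve-∀

  p∣A²+B²·y² : + p ∣ᶻ ((A *ᶻ A +ᶻ B *ᶻ B) *ᶻ (y *ᶻ y))
  p∣A²+B²·y² = subst (+ p ∣ᶻ_) (sym (key-identity A B x y))
    (ℤ∣.∣m∣n⇒∣m+n (ℤ∣.∣m⇒∣m*n _ p∣Ay-Bx) (ℤ∣.∣n⇒∣m*n (B *ᶻ B) p∣x²+y²))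

  p∣A²+B² : + p ∣ᶻ (A *ᶻ A +ᶻ B *ᶻ B)
  p∣A²+B² with euclidᶻ p-prime _ _ p∣A²+B²·y²
  ... | inj₁ p∣A²+B² = p∣A²+B²
  ... | inj₂ p∣y² with euclidᶻ p-prime y y p∣y²
  ...   | inj₁ p∣y = ⊥-elim (p∤y p∣y)
  ...   | inj₂ p∣y = ⊥-elim (p∤y p∣y)

  p∣∣A∣²+∣B∣² : p ∣ ∣ A ∣ * ∣ A ∣ + ∣ B ∣ * ∣ B ∣
  p∣∣A∣²+∣B∣² = ℤ∣.∣⇒∣ᵤ (subst (+ p ∣ᶻ_)
    (trans (cong₂ _+ᶻ_ (square-abs A) (square-abs B)) (sym (ℤ.pos-+ (∣ A ∣ * ∣ A ∣) (∣ B ∣ * ∣ B ∣)))) p∣A²+B²)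

coprime-to-prime : Prime p → ∀ {n} → ¬ p ∣ n → Coprime n p
coprime-to-prime p-prime p∤n (i∣n , i∣p) with prime⇒irreducible p-prime i∣p
... | inj₁ i≡1 = i≡1
... | inj₂ refl = ⊥-elim (p∤n i∣n)

identityᶻ : ∀ a b c d → 1 + a * b ≡ c * d → + 1 +ᶻ + a *ᶻ + b ≡ + c *ᶻ + d
identityᶻ a b c d eq = begin
  + 1 +ᶻ + a *ᶻ + b   ≡⟨ cong (+ 1 +ᶻ_) (ℤ.pos-* a b) ⟨
  + 1 +ᶻ + (a * b)    ≡⟨ ℤ.pos-+ 1 (a * b) ⟨
  + (1 + a * b)       ≡⟨ cong +_ eq ⟩
  + (c * d)           ≡⟨ ℤ.pos-* c d ⟩
  + c *ᶻ + d          ∎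
  where open ≡-Reasoning

inverse-mod : Prime p → ∀ {n} → ¬ p ∣ n → ∃[ u ] (+ p ∣ᶻ (+ n *ᶻ u -ᶻ + 1))
inverse-mod {p} p-prime {n} p∤n with coprime-Bézout (coprime-to-prime p-prime p∤n)
... | Bézout.+- x y 1+yp≡xn = + x , divides (+ y) (begin
  + n *ᶻ + x -ᶻ + 1            ≡⟨ cong (_-ᶻ + 1) (ℤ.*-comm (+ n) (+ x)) ⟩
  + x *ᶻ + n -ᶻ + 1            ≡⟨ cong (_-ᶻ + 1) (identityᶻ y p x n 1+yp≡xn) ⟨
  + 1 +ᶻ + y *ᶻ + p -ᶻ + 1     ≡⟨ cancel-one (+ y *ᶻ + p) ⟩
  + y *ᶻ + p                   ∎)
  where
  open ≡-Reasoning
  cancel-one : ∀ z → + 1 +ᶻ z -ᶻ + 1 ≡ z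
  cancel-one = solve-∀
... | Bézout.-+ x y 1+xn≡yp = -ᶻ + x , divides (-ᶻ + y) (begin
  + n *ᶻ (-ᶻ + x) -ᶻ + 1       ≡⟨ negate (+ n) (+ x) ⟩
  -ᶻ (+ 1 +ᶻ + x *ᶻ + n)       ≡⟨ cong -ᶻ_ (identityᶻ x n y p 1+xn≡yp) ⟩
  -ᶻ (+ y *ᶻ + p)              ≡⟨ ℤ.neg-distribˡ-* (+ y) (+ p) ⟩
  -ᶻ + y *ᶻ + p                ∎)
  where
  open ≡-Reasoning
  negate : ∀ n x → n *ᶻ (-ᶻ x) -ᶻ + 1 ≡ -ᶻ (+ 1 +ᶻ x *ᶻ n)
  negate = solve-∀

-- Linear congruences modulo a prime are solvable: if p ∤ a, then for every q
-- some t satisfies q + a·t ≡ 0 (mod p), namely t = −q·a⁻¹.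
solve-linear-mod : Prime p → ∀ {a} → ¬ + p ∣ᶻ a → ∀ q → ∃[ t ] (+ p ∣ᶻ (q +ᶻ a *ᶻ t))
solve-linear-mod {p} p-prime {+ n} p∤a q with inverse-mod p-prime (p∤a ∘ ℤ∣.∣ᵤ⇒∣)
... | u , p∣nu-1 = -ᶻ (q *ᶻ u) , subst (+ p ∣ᶻ_) (rearrange q (+ n) u) (ℤ∣.∣n⇒∣m*n (-ᶻ q) p∣nu-1)
  where
  rearrange : ∀ q n u → -ᶻ q *ᶻ (n *ᶻ u -ᶻ + 1) ≡ q +ᶻ n *ᶻ (-ᶻ (q *ᶻ u))
  rearrange = solve-∀
solve-linear-mod {p} p-prime { -[1+ n ]} p∤a q with inverse-mod p-prime {suc n} (p∤a ∘ ℤ∣.∣ᵤ⇒∣)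
... | u , p∣nu-1 = q *ᶻ u , subst (+ p ∣ᶻ_) (rearrange q (+ suc n) u) (ℤ∣.∣n⇒∣m*n (-ᶻ q) p∣nu-1)
  where
  rearrange : ∀ q n u → -ᶻ q *ᶻ (n *ᶻ u -ᶻ + 1) ≡ q +ᶻ (-ᶻ n) *ᶻ (q *ᶻ u)
  rearrange = solve-∀

-- Let p be prime and p ∣ P.  A root x of x² ≡ c (mod P)
-- with p ∤ 2x lifts to the root x + t·P modulo p·P, where t is chosen so
-- that (x² − c)/P + 2x·t ≡ 0 (mod p); the new root is ≡ x (mod p).
hensel-step : Prime p → ∀ {P c x} → + p ∣ᶻ + P → ¬ + p ∣ᶻ (+ 2 *ᶻ x) → + P ∣ᶻ (x *ᶻ x -ᶻ c) →
              ∃[ x′ ] (+ (p * P) ∣ᶻ (x′ *ᶻ x′ -ᶻ c) × + p ∣ᶻ (x′ -ᶻ x))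
hensel-step {p} p-prime {P} {c} {x} p∣P p∤2x (divides Q x²-c≡QP)
  with solve-linear-mod p-prime p∤2x Q
... | t , p∣Q+2xt = x +ᶻ t *ᶻ + P , pP∣ , subst (+ p ∣ᶻ_) (sym (shift x t (+ P))) (ℤ∣.∣n⇒∣m*n t p∣P)
  where
  expand : ∀ x c t P → (x +ᶻ t *ᶻ P) *ᶻ (x +ᶻ t *ᶻ P) -ᶻ c ≡ (x *ᶻ x -ᶻ c) +ᶻ P *ᶻ (+ 2 *ᶻ x *ᶻ t) +ᶻ t *ᶻ t *ᶻ (P *ᶻ P)
  expand = solve-∀
  collect : ∀ Q P x t → Q *ᶻ P +ᶻ P *ᶻ (+ 2 *ᶻ x *ᶻ t) ≡ P *ᶻ (Q +ᶻ + 2 *ᶻ x *ᶻ t)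
  collect = solve-∀
  shift : ∀ x t P → x +ᶻ t *ᶻ P -ᶻ x ≡ t *ᶻ P
  shift = solve-∀

  pP≡Pp : + (p * P) ≡ + P *ᶻ + p
  pP≡Pp = trans (cong +_ (*-comm p P)) (ℤ.pos-* P p)

  pP∣ : + (p * P) ∣ᶻ ((x +ᶻ t *ᶻ + P) *ᶻ (x +ᶻ t *ᶻ + P) -ᶻ c)
  pP∣ = subst₂ _∣ᶻ_ (sym pP≡Pp) (sym (begin
    (x +ᶻ t *ᶻ + P) *ᶻ (x +ᶻ t *ᶻ + P) -ᶻ c
      ≡⟨ expand x c t (+ P) ⟩
    (x *ᶻ x -ᶻ c) +ᶻ + P *ᶻ (+ 2 *ᶻ x *ᶻ t) +ᶻ t *ᶻ t *ᶻ (+ P *ᶻ + P)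
      ≡⟨ cong (λ z → z +ᶻ + P *ᶻ (+ 2 *ᶻ x *ᶻ t) +ᶻ t *ᶻ t *ᶻ (+ P *ᶻ + P)) x²-c≡QP ⟩
    Q *ᶻ + P +ᶻ + P *ᶻ (+ 2 *ᶻ x *ᶻ t) +ᶻ t *ᶻ t *ᶻ (+ P *ᶻ + P)
      ≡⟨ cong (_+ᶻ t *ᶻ t *ᶻ (+ P *ᶻ + P)) (collect Q (+ P) x t) ⟩
    + P *ᶻ (Q +ᶻ + 2 *ᶻ x *ᶻ t) +ᶻ t *ᶻ t *ᶻ (+ P *ᶻ + P) ∎))
    (ℤ∣.∣m∣n⇒∣m+n (ℤ∣.*-monoʳ-∣ (+ P) p∣Q+2xt)
                  (ℤ∣.∣n⇒∣m*n (t *ᶻ t) (ℤ∣.*-monoʳ-∣ (+ P) p∣P)))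
    where open ≡-Reasoning

odd-prime∤2x : Prime p → 2 < p → ∀ {x} → ¬ + p ∣ᶻ x → ¬ + p ∣ᶻ (+ 2 *ᶻ x)
odd-prime∤2x p-prime 2<p p∤x p∣2x with euclidᶻ p-prime (+ 2) _ p∣2x
... | inj₁ p∣2 = <⇒≱ 2<p (∣⇒≤ (ℤ∣.∣⇒∣ᵤ p∣2))
... | inj₂ p∣x = p∤x p∣x

hensel : Prime p → 2 < p → ∀ {c x₀} → ¬ + p ∣ᶻ x₀ → + p ∣ᶻ (x₀ *ᶻ x₀ -ᶻ c) →
         ∀ m → ∃[ x ] (+ (p ^ suc m) ∣ᶻ (x *ᶻ x -ᶻ c) × ¬ + p ∣ᶻ x)
hensel {p} p-prime 2<p {c} {x₀} p∤x₀ p∣ zero =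
  x₀ , subst (λ P → + P ∣ᶻ (x₀ *ᶻ x₀ -ᶻ c)) (sym (*-identityʳ p)) p∣ , p∤x₀
hensel {p} p-prime 2<p p∤x₀ p∣ (suc m) =
  let x , p^m+1∣ , p∤x = hensel p-prime 2<p p∤x₀ p∣ m
      x′ , p^m+2∣ , p∣x′-x = hensel-step p-prime {P = p ^ suc m} (ℤ∣.∣ᵤ⇒∣ (m∣m*n (p ^ m)))
                                         (odd-prime∤2x p-prime 2<p p∤x) p^m+1∣
  in x′ , p^m+2∣ , λ p∣x′ →
     p∤x (subst (+ p ∣ᶻ_) (ℤ.neg-involutive x) (ℤ∣.∣m⇒∣-m (ℤ∣.∣m+n∣m⇒∣n p∣x′-x p∣x′)))

-- Modulo every power of an odd prime p, each integer prime to p is a sum of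
-- two squares: write it as x₀² + y₀² modulo p, where p cannot divide both
-- x₀ and y₀, and lift the coordinate prime to p by Hensel's lemma.
unit-sum-of-two-squares : Prime p → 2 < p → ∀ {h} → suc p ≡ h + h → ∀ {a} → ¬ + p ∣ᶻ a →
                          ∀ n → SumOfTwoSquaresMod (p ^ suc n) a
unit-sum-of-two-squares {p} p-prime 2<p {h} p+1≡2h {a} p∤a n =
  lift (every-residue-sum-of-two-squares p-prime {h} p+1≡2h a)
  where
  as-root : ∀ x y a → x *ᶻ x +ᶻ y *ᶻ y -ᶻ a ≡ x *ᶻ x -ᶻ (a -ᶻ y *ᶻ y)
  as-root = solve-∀
  swap : ∀ x y a → x *ᶻ x +ᶻ y *ᶻ y -ᶻ a ≡ y *ᶻ y +ᶻ x *ᶻ x -ᶻ a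
  swap = solve-∀
  recover : ∀ x y a → (x *ᶻ x +ᶻ y *ᶻ y) -ᶻ (x *ᶻ x +ᶻ y *ᶻ y -ᶻ a) ≡ a
  recover = solve-∀

  lift-first : ∀ x₀ y₀ → ¬ + p ∣ᶻ x₀ → + p ∣ᶻ (x₀ *ᶻ x₀ +ᶻ y₀ *ᶻ y₀ -ᶻ a) →
               SumOfTwoSquaresMod (p ^ suc n) a
  lift-first x₀ y₀ p∤x₀ p∣ =
    let x , p^n+1∣ , _ = hensel p-prime 2<p p∤x₀ (subst (+ p ∣ᶻ_) (as-root x₀ y₀ a) p∣) n
    in x , y₀ , subst (+ (p ^ suc n) ∣ᶻ_) (sym (as-root x y₀ a)) p^n+1∣

  lift : SumOfTwoSquaresMod p a → SumOfTwoSquaresMod (p ^ suc n) a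
  lift (x₀ , y₀ , p∣) with + p ℤ∣.∣? x₀ | + p ℤ∣.∣? y₀
  ... | no p∤x₀ | _ = lift-first x₀ y₀ p∤x₀ p∣
  ... | yes _ | no p∤y₀ = lift-first y₀ x₀ p∤y₀ (subst (+ p ∣ᶻ_) (swap x₀ y₀ a) p∣)
  ... | yes p∣x₀ | yes p∣y₀ = ⊥-elim (p∤a (subst (+ p ∣ᶻ_) (recover x₀ y₀ a)
          (ℤ∣.∣m∣n⇒∣m-n (ℤ∣.∣m∣n⇒∣m+n (ℤ∣.∣m⇒∣m*n x₀ p∣x₀) (ℤ∣.∣m⇒∣m*n y₀ p∣y₀)) p∣)))

alpha : ℕ → ℕ → ℕ
alpha p zero = 1
alpha p (suc zero) = p
alpha p (suc (suc n)) = (p ∸ 1) * p ^ suc n + alpha p n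

-- p^(n+1) = p·pⁿ, with the exponent written as in the closed form.
^-+1 : ∀ p n → p ^ (n + 1) ≡ p * p ^ n
^-+1 p n = cong (p ^_) (+-comm n 1)

alpha-closed-form : ∀ p .{{_ : NonZero p}} n →
  (n % 2 ≡ 1 → (p + 1) * alpha p n ≡ p * (p ^ n + 1)) ×
  (n % 2 ≡ 0 → (p + 1) * alpha p n ≡ p ^ (n + 1) + 1)
alpha-closed-form (suc r) zero = (λ ()) , λ _ → identity r
  where
  identity : ∀ r → (suc r + 1) * 1 ≡ suc r * 1 + 1
  identity = ℕ-Ring.solve-∀
alpha-closed-form (suc r) (suc zero) = (λ _ → identity r) , λ ()
  where
  identity : ∀ r → (suc r + 1) * suc r ≡ suc r * (suc r * 1 + 1)
  identity = ℕ-Ring.solve-∀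
alpha-closed-form p@(suc r) (suc (suc n)) = odd , even
  where
  open ≡-Reasoning
  X = p ^ n
  step : (p + 1) * alpha p (suc (suc n)) ≡ (p + 1) * (r * (p * X)) + (p + 1) * alpha p n
  step = *-distribˡ-+ (p + 1) (r * (p * X)) (alpha p n)

  odd : n % 2 ≡ 1 → (p + 1) * alpha p (suc (suc n)) ≡ p * (p * (p * X) + 1)
  odd n-odd = begin
    (p + 1) * alpha p (suc (suc n))             ≡⟨ step ⟩
    (p + 1) * (r * (p * X)) + (p + 1) * alpha p n ≡⟨ cong (λ t → (p + 1) * (r * (p * X)) + t) (proj₁ (alpha-closed-form p n) n-odd) ⟩
    (p + 1) * (r * (p * X)) + p * (X + 1)        ≡⟨ identity r X ⟩
    p * (p * (p * X) + 1)                        ∎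
    where
    identity : ∀ r X → (suc r + 1) * (r * (suc r * X)) + suc r * (X + 1) ≡ suc r * (suc r * (suc r * X) + 1)
    identity = ℕ-Ring.solve-∀

  even : n % 2 ≡ 0 → (p + 1) * alpha p (suc (suc n)) ≡ p ^ (suc (suc n) + 1) + 1
  even n-even = begin
    (p + 1) * alpha p (suc (suc n))             ≡⟨ step ⟩
    (p + 1) * (r * (p * X)) + (p + 1) * alpha p n ≡⟨ cong (λ t → (p + 1) * (r * (p * X)) + t) (proj₂ (alpha-closed-form p n) n-even) ⟩
    (p + 1) * (r * (p * X)) + (p ^ (n + 1) + 1)  ≡⟨ cong (λ Y → (p + 1) * (r * (p * X)) + (Y + 1)) (^-+1 p n) ⟩
    (p + 1) * (r * (p * X)) + (p * X + 1)        ≡⟨ identity r X ⟩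
    p * (p * (p * X)) + 1                        ≡⟨ cong (λ Y → p * (p * Y) + 1) (^-+1 p n) ⟨
    p ^ (suc (suc n) + 1) + 1                    ∎
    where
    identity : ∀ r X → (suc r + 1) * (r * (suc r * X)) + (suc r * X + 1) ≡ suc r * (suc r * (suc r * X)) + 1
    identity = ℕ-Ring.solve-∀

parity-flip : ∀ m → (suc m % 2 ≡ 1 → m % 2 ≡ 0) × (suc m % 2 ≡ 0 → m % 2 ≡ 1)
parity-flip zero = (λ _ → refl) , λ ()
parity-flip (suc zero) = (λ ()) , λ _ → refl
parity-flip (suc (suc m)) = parity-flip m

-- Comparing the closed forms of consecutive values:
--   α(p^(m+1)) = p·α(p^m)          if m + 1 is odd,
--   α(p^(m+1)) = p·α(p^m) − p + 1  if m + 1 is even.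
alpha-recurrence : ∀ p .{{_ : NonZero p}} m →
  (suc m % 2 ≡ 1 → alpha p (suc m) ≡ p * alpha p m) ×
  (suc m % 2 ≡ 0 → alpha p (suc m) ≡ p * alpha p m ∸ p + 1)
alpha-recurrence p@(suc r) m = odd , even
  where
  open ≡-Reasoning
  X = p ^ m

  odd : suc m % 2 ≡ 1 → alpha p (suc m) ≡ p * alpha p m
  odd m+1-odd = *-cancelˡ-≡ _ _ (p + 1) (begin
    (p + 1) * alpha p (suc m)  ≡⟨ proj₁ (alpha-closed-form p (suc m)) m+1-odd ⟩
    p * (p * X + 1)            ≡⟨ cong (λ Y → p * (Y + 1)) (^-+1 p m) ⟨
    p * (p ^ (m + 1) + 1)      ≡⟨ cong (p *_) (proj₂ (alpha-closed-form p m) (proj₁ (parity-flip m) m+1-odd)) ⟨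
    p * ((p + 1) * alpha p m)  ≡⟨ swap p (alpha p m) ⟩
    (p + 1) * (p * alpha p m)  ∎)
    where
    swap : ∀ p a → p * ((p + 1) * a) ≡ (p + 1) * (p * a)
    swap = ℕ-Ring.solve-∀

  even-step : ∀ c → (p + 1) * c ≡ p * (X + 1) → (p + 1) * (p * c ∸ p + 1) ≡ p * (p * X) + 1
  even-step zero eq = ⊥-elim (≢-nonZero⁻¹ (p * suc X) {{m*n≢0 p (suc X)}} (trans (cong (p *_) (+-comm 1 X)) (sym (trans (sym (*-zeroʳ (p + 1))) eq))))
  even-step (suc c) eq = begin
    (p + 1) * (p * suc c ∸ p + 1)  ≡⟨ cong (λ t → (p + 1) * (t ∸ p + 1)) (*-suc p c) ⟩
    (p + 1) * (p + p * c ∸ p + 1)  ≡⟨ cong (λ t → (p + 1) * (t + 1)) (m+n∸m≡n p (p * c)) ⟩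
    (p + 1) * (p * c + 1)          ≡⟨ regroup r c ⟩
    p * ((p + 1) * c + 1) + 1      ≡⟨ cong (λ t → p * t + 1) (+-cancelʳ-≡ p _ _ (trans (split r c) (trans eq (expand r X)))) ⟩
    p * (p * X) + 1                ∎
    where
    regroup : ∀ r c → (suc r + 1) * (suc r * c + 1) ≡ suc r * ((suc r + 1) * c + 1) + 1
    regroup = ℕ-Ring.solve-∀
    split : ∀ r c → (suc r + 1) * c + 1 + suc r ≡ (suc r + 1) * suc c
    split = ℕ-Ring.solve-∀
    expand : ∀ r X → suc r * (X + 1) ≡ suc r * X + suc r
    expand = ℕ-Ring.solve-∀

  even : suc m % 2 ≡ 0 → alpha p (suc m) ≡ p * alpha p m ∸ p + 1
  even m+1-even = *-cancelˡ-≡ _ _ (p + 1) (begin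
    (p + 1) * alpha p (suc m)          ≡⟨ proj₂ (alpha-closed-form p (suc m)) m+1-even ⟩
    p * p ^ (m + 1) + 1                ≡⟨ cong (λ Y → p * Y + 1) (^-+1 p m) ⟩
    p * (p * X) + 1                    ≡⟨ even-step (alpha p m) previous ⟨
    (p + 1) * (p * alpha p m ∸ p + 1)  ∎)
    where
    previous : (p + 1) * alpha p m ≡ p * (X + 1)
    previous = proj₁ (alpha-closed-form p m) (proj₂ (parity-flip m) m+1-even)

A-intro : ∀ {n a} → a < n → SumOfTwoSquaresMod n (+ a) → A n a
A-intro a<n (x , y , n∣) = a<n , x , y , ℤ∣.∣⇒∣ᵤ n∣
A-sum : ∀ {n a} → A n a → SumOfTwoSquaresMod n (+ a)
A-sum (_ , x , y , n∣) = x , y , ℤ∣.∣ᵤ⇒∣ n∣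

A-zero : ∀ {n} → 0 < n → A n 0
A-zero 0<n = A-intro 0<n (+ 0 , + 0 , divides (+ 0) refl)

A-one : ∀ a → a < 1 ⇔ A 1 a
A-one a = mk⇔ (λ { (s≤s z≤n) → A-zero (s≤s z≤n) }) proj₁

scale : ∀ {n b} k → SumOfTwoSquaresMod n (+ b) → SumOfTwoSquaresMod (n * (k * k)) (+ (b * (k * k)))
scale {n} {b} k (x , y , divides Q x²+y²-b≡Qn) = x *ᶻ + k , y *ᶻ + k , divides Q (begin
  (x *ᶻ + k) *ᶻ (x *ᶻ + k) +ᶻ (y *ᶻ + k) *ᶻ (y *ᶻ + k) -ᶻ + (b * (k * k))
    ≡⟨ cong (λ t → (x *ᶻ + k) *ᶻ (x *ᶻ + k) +ᶻ (y *ᶻ + k) *ᶻ (y *ᶻ + k) -ᶻ t) (ℤ.pos-* b (k * k)) ⟩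
  (x *ᶻ + k) *ᶻ (x *ᶻ + k) +ᶻ (y *ᶻ + k) *ᶻ (y *ᶻ + k) -ᶻ + b *ᶻ + (k * k)
    ≡⟨ cong (λ t → (x *ᶻ + k) *ᶻ (x *ᶻ + k) +ᶻ (y *ᶻ + k) *ᶻ (y *ᶻ + k) -ᶻ + b *ᶻ t) (ℤ.pos-* k k) ⟩
  (x *ᶻ + k) *ᶻ (x *ᶻ + k) +ᶻ (y *ᶻ + k) *ᶻ (y *ᶻ + k) -ᶻ + b *ᶻ (+ k *ᶻ + k)
    ≡⟨ factor x y (+ b) (+ k) ⟩
  (x *ᶻ x +ᶻ y *ᶻ y -ᶻ + b) *ᶻ (+ k *ᶻ + k)   ≡⟨ cong (_*ᶻ (+ k *ᶻ + k)) x²+y²-b≡Qn ⟩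
  Q *ᶻ + n *ᶻ (+ k *ᶻ + k)                   ≡⟨ ℤ.*-assoc Q (+ n) (+ k *ᶻ + k) ⟩
  Q *ᶻ (+ n *ᶻ (+ k *ᶻ + k))                 ≡⟨ cong (λ t → Q *ᶻ (+ n *ᶻ t)) (ℤ.pos-* k k) ⟨
  Q *ᶻ (+ n *ᶻ + (k * k))                    ≡⟨ cong (Q *ᶻ_) (ℤ.pos-* n (k * k)) ⟨
  Q *ᶻ + (n * (k * k))                       ∎)
  where
  open ≡-Reasoning
  factor : ∀ x y b k → (x *ᶻ k) *ᶻ (x *ᶻ k) +ᶻ (y *ᶻ k) *ᶻ (y *ᶻ k) -ᶻ b *ᶻ (k *ᶻ k) ≡ (x *ᶻ x +ᶻ y *ᶻ y -ᶻ b) *ᶻ (k *ᶻ k)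
  factor = solve-∀

lift-bound : ∀ {m k b} → Lift m k b → b < k * m
lift-bound {m} {k} (a , j , (a<m , _) , j<k , refl) = begin-strict
  a + j * m   <⟨ +-monoˡ-< (j * m) a<m ⟩
  suc j * m   ≤⟨ *-monoˡ-≤ m j<k ⟩
  k * m       ∎
  where open ≤-Reasoning

module PrimeThreeModFour {p : ℕ} (p-prime : Prime p) (p≡3 : p % 4 ≡ 3) where

  instance
    p≢0 : NonZero p
    p≢0 = prime⇒nonZero p-prime

  -- p ≥ 3, so p ∤ 2 as Hensel lifting requires.
  2<p : 2 < p
  2<p = at-least-3 p≡3
    where
    at-least-3 : ∀ {q} → q % 4 ≡ 3 → 2 < q
    at-least-3 {suc (suc (suc _))} _ = s≤s (s≤s (s≤s z≤n))

  h : ℕ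
  h = 2 + p / 4 * 2

  p+1≡2h : suc p ≡ h + h
  p+1≡2h = begin
    suc p                  ≡⟨ cong suc (m≡m%n+[m/n]*n p 4) ⟩
    suc (p % 4 + p / 4 * 4) ≡⟨ cong (λ r → suc (r + p / 4 * 4)) p≡3 ⟩
    4 + p / 4 * 4          ≡⟨ identity (p / 4) ⟩
    h + h                  ∎
    where
    open ≡-Reasoning
    identity : ∀ q → 4 + q * 4 ≡ (2 + q * 2) + (2 + q * 2)
    identity = ℕ-Ring.solve-∀

  p²≢0 : NonZero (p * p)
  p²≢0 = m*n≢0 p p

  power : ∀ n → p ^ n * (p * p) ≡ p ^ suc (suc n)
  power n = identity p (p ^ n)
    where
    identity : ∀ p X → X * (p * p) ≡ p * (p * X)
    identity = ℕ-Ring.solve-∀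

  scaled-below : ∀ {n b} → b < p ^ n → b * (p * p) < p ^ suc (suc n)
  scaled-below {n} {b} b<pⁿ = subst (b * (p * p) <_) (power n) (*-monoˡ-< (p * p) {{p²≢0}} b<pⁿ)

  below-scaled : ∀ {n b} → b * (p * p) < p ^ suc (suc n) → b < p ^ n
  below-scaled {n} {b} bp²<pⁿ⁺² = *-cancelʳ-< (p * p) b (p ^ n) (subst (b * (p * p) <_) (sym (power n)) bp²<pⁿ⁺²)

  A-prime : ∀ a → a < p ⇔ A (p ^ 1) a
  A-prime a = mk⇔
    (λ a<p → A-intro (subst (a <_) (sym (*-identityʳ p)) a<p)
      (subst (λ m → SumOfTwoSquaresMod m (+ a)) (sym (*-identityʳ p))
        (every-residue-sum-of-two-squares p-prime {h} p+1≡2h (+ a))))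
    (λ (a<p¹ , _) → subst (a <_) (*-identityʳ p) a<p¹)

  -- Descent: if a ≡ x² + y² (mod p^(n+2)) and p ∣ a, then p ∣ x and p ∣ y
  -- (as p ≡ 3 mod 4), hence a = b·p² with b ≡ (x/p)² + (y/p)² (mod pⁿ).
  descent : ∀ n {a} → SumOfTwoSquaresMod (p ^ suc (suc n)) (+ a) → p ∣ a →
            ∃[ b ] (a ≡ b * (p * p) × SumOfTwoSquaresMod (p ^ n) (+ b))
  descent n {a} (x , y , p^n+2∣@(divides Q x²+y²-a≡Q·pⁿ⁺²)) p∣a =
    divide-out (prime-3mod4-∣-sum-of-squares p-prime p≡3 y x (subst (+ p ∣ᶻ_) (ℤ.+-comm (x *ᶻ x) (y *ᶻ y)) p∣x²+y²))
               (prime-3mod4-∣-sum-of-squares p-prime p≡3 x y p∣x²+y²)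
    where
    add-back : ∀ s a → s -ᶻ a +ᶻ a ≡ s
    add-back = solve-∀
    p∣x²+y² : + p ∣ᶻ (x *ᶻ x +ᶻ y *ᶻ y)
    p∣x²+y² = subst (+ p ∣ᶻ_) (add-back (x *ᶻ x +ᶻ y *ᶻ y) (+ a))
      (ℤ∣.∣m∣n⇒∣m+n (ℤ∣.∣-trans (ℤ∣.∣ᵤ⇒∣ (m∣m*n (p ^ suc n))) p^n+2∣) (ℤ∣.∣ᵤ⇒∣ p∣a))

    Pⁿ : ℤ
    Pⁿ = + (p ^ n)
    powerᶻ : + (p ^ suc (suc n)) ≡ Pⁿ *ᶻ (+ p *ᶻ + p)
    powerᶻ = trans (cong +_ (sym (power n))) (trans (ℤ.pos-* (p ^ n) (p * p)) (cong (Pⁿ *ᶻ_) (ℤ.pos-* p p)))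

    divide-out : + p ∣ᶻ x → + p ∣ᶻ y → ∃[ b ] (a ≡ b * (p * p) × SumOfTwoSquaresMod (p ^ n) (+ b))
    divide-out (divides X x≡Xp) (divides Y y≡Yp) = quotient (ℤ∣.∣⇒∣ᵤ (divides S a≡S·p²))
      where
      S : ℤ
      S = X *ᶻ X +ᶻ Y *ᶻ Y -ᶻ Q *ᶻ Pⁿ
      recover : ∀ s a → s -ᶻ (s -ᶻ a) ≡ a
      recover = solve-∀
      factor : ∀ X Y Q P K → (X *ᶻ K) *ᶻ (X *ᶻ K) +ᶻ (Y *ᶻ K) *ᶻ (Y *ᶻ K) -ᶻ Q *ᶻ (P *ᶻ (K *ᶻ K)) ≡
                             (X *ᶻ X +ᶻ Y *ᶻ Y -ᶻ Q *ᶻ P) *ᶻ (K *ᶻ K)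
      factor = solve-∀
      a≡S·p² : + a ≡ S *ᶻ + (p * p)
      a≡S·p² = begin
        + a                                          ≡⟨ recover (x *ᶻ x +ᶻ y *ᶻ y) (+ a) ⟨
        x *ᶻ x +ᶻ y *ᶻ y -ᶻ (x *ᶻ x +ᶻ y *ᶻ y -ᶻ + a) ≡⟨ cong (λ t → x *ᶻ x +ᶻ y *ᶻ y -ᶻ t) x²+y²-a≡Q·pⁿ⁺² ⟩
        x *ᶻ x +ᶻ y *ᶻ y -ᶻ Q *ᶻ + (p ^ suc (suc n))  ≡⟨ cong₂ (λ u v → u *ᶻ u +ᶻ v *ᶻ v -ᶻ Q *ᶻ + (p ^ suc (suc n))) x≡Xp y≡Yp ⟩
        (X *ᶻ + p) *ᶻ (X *ᶻ + p) +ᶻ (Y *ᶻ + p) *ᶻ (Y *ᶻ + p) -ᶻ Q *ᶻ + (p ^ suc (suc n))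
                                                     ≡⟨ cong (λ t → (X *ᶻ + p) *ᶻ (X *ᶻ + p) +ᶻ (Y *ᶻ + p) *ᶻ (Y *ᶻ + p) -ᶻ Q *ᶻ t) powerᶻ ⟩
        (X *ᶻ + p) *ᶻ (X *ᶻ + p) +ᶻ (Y *ᶻ + p) *ᶻ (Y *ᶻ + p) -ᶻ Q *ᶻ (Pⁿ *ᶻ (+ p *ᶻ + p))
                                                     ≡⟨ factor X Y Q Pⁿ (+ p) ⟩
        S *ᶻ (+ p *ᶻ + p)                            ≡⟨ cong (S *ᶻ_) (ℤ.pos-* p p) ⟨
        S *ᶻ + (p * p)                               ∎
        where open ≡-Reasoning

      quotient : (p * p) ∣ a → ∃[ b ] (a ≡ b * (p * p) × SumOfTwoSquaresMod (p ^ n) (+ b))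
      quotient (divides b a≡b·p²) = b , a≡b·p² , X , Y , divides Q (begin
        X *ᶻ X +ᶻ Y *ᶻ Y -ᶻ + b  ≡⟨ cong (λ t → X *ᶻ X +ᶻ Y *ᶻ Y -ᶻ t) b≡S ⟩
        X *ᶻ X +ᶻ Y *ᶻ Y -ᶻ S    ≡⟨ recover (X *ᶻ X +ᶻ Y *ᶻ Y) (Q *ᶻ Pⁿ) ⟩
        Q *ᶻ Pⁿ                  ∎)
        where
        open ≡-Reasoning
        b≡S : + b ≡ S
        b≡S = ℤ.*-cancelʳ-≡ (+ b) S (+ (p * p)) {{p²≢0}}
                (trans (sym (ℤ.pos-* b (p * p))) (trans (cong +_ (sym a≡b·p²)) a≡S·p²))

  -- The recursive structure of A_{p^(n+2)}: its elements are the residues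
  -- prime to p (all are sums of two squares, by Hensel lifting) together with
  -- the numbers b·p² for b ∈ A_{pⁿ} (by descent and scaling).
  A-split : ∀ n a → A (p ^ suc (suc n)) a ⇔
            ((a < p ^ suc (suc n) × ¬ p ∣ a) ⊎ ∃[ b ] (A (p ^ n) b × a ≡ b * (p * p)))
  A-split n a = mk⇔ split join
    where
    split : A (p ^ suc (suc n)) a → (a < p ^ suc (suc n) × ¬ p ∣ a) ⊎ ∃[ b ] (A (p ^ n) b × a ≡ b * (p * p))
    split a∈A@(a<pⁿ⁺² , _) with p ∣? a
    ... | no p∤a = inj₁ (a<pⁿ⁺² , p∤a)
    ... | yes p∣a =
      let b , a≡b·p² , b-sum = descent n (A-sum a∈A) p∣a
      in inj₂ (b , A-intro (below-scaled {n} (subst (_< p ^ suc (suc n)) a≡b·p² a<pⁿ⁺²)) b-sum , a≡b·p²)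

    join : (a < p ^ suc (suc n) × ¬ p ∣ a) ⊎ ∃[ b ] (A (p ^ n) b × a ≡ b * (p * p)) → A (p ^ suc (suc n)) a
    join (inj₁ (a<pⁿ⁺² , p∤a)) =
      A-intro a<pⁿ⁺² (unit-sum-of-two-squares p-prime 2<p {h} p+1≡2h (p∤a ∘ ℤ∣.∣⇒∣ᵤ) (suc n))
    join (inj₂ (b , b∈A , refl)) =
      A-intro (scaled-below {n} (proj₁ b∈A))
              (subst (λ m → SumOfTwoSquaresMod m (+ (b * (p * p)))) (power n) (scale p (A-sum b∈A)))

  -- α(pⁿ) = alpha p n: count the two disjoint parts of A-split.
  card-A : ∀ n → α≡ (p ^ n) (alpha p n)
  card-A zero = card-resp A-one (card-range 1)
  card-A (suc zero) = card-resp A-prime (card-range p)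
  card-A (suc (suc n)) = card-resp (λ a → ⇔.sym (A-split n a))
    (card-union (card-non-multiples p (p ^ suc n))
                (card-image (_* (p * p)) (λ {x} {y} → *-cancelʳ-≡ x y (p * p) {{p²≢0}}) (card-A n))
                disjoint)
    where
    disjoint : ∀ a → a < p ^ suc (suc n) × ¬ p ∣ a → ∃[ b ] (A (p ^ n) b × a ≡ b * (p * p)) → ⊥
    disjoint a (_ , p∤a) (b , _ , refl) = p∤a (divides (b * p) (sym (*-assoc b p p)))

  -- N_{p²} = {jp : 0 < j < p}: a number below p² lies outside A_{p²} exactly
  -- when it is a nonzero multiple of p.
  N-square : ∀ b → N p 2 b ⇔ (∃[ j ] (0 < j × j < p × b ≡ j * p))
  N-square b = mk⇔ forward backward
    where
    forward : N p 2 b → ∃[ j ] (0 < j × j < p × b ≡ j * p)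
    forward (b∈lift , b∉A) with p ∣? b
    ... | no p∤b = ⊥-elim (b∉A (from (A-split 0 b) (inj₁ (lift-bound b∈lift , p∤b))))
    ... | yes (divides j b≡jp) = j , 0<j , j<p , b≡jp
      where
      0<j : 0 < j
      0<j = n≢0⇒n>0 (λ { refl → b∉A (subst (A (p ^ 2)) (sym b≡jp) (A-zero (m^n>0 p 2))) })
      j<p : j < p
      j<p = *-cancelʳ-< p j p (subst₂ _<_ b≡jp (cong (p *_) (*-identityʳ p)) (lift-bound b∈lift))

    backward : ∃[ j ] (0 < j × j < p × b ≡ j * p) → N p 2 b
    backward (j , 0<j , j<p , refl) =
      (0 , j , A-zero (m^n>0 p 1) , j<p , cong (j *_) (sym (*-identityʳ p))) , jp∉A
      where
      jp∉A : ¬ A (p ^ 2) (j * p)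
      jp∉A jp∈A with to (A-split 0 (j * p)) jp∈A
      ... | inj₁ (_ , p∤jp) = p∤jp (divides j refl)
      ... | inj₂ (c , (c<1 , _) , jp≡c·p²) =
        <-irrefl (sym (m*n≡0⇒m≡0 j p (trans jp≡c·p² (cong (_* (p * p)) (n<1⇒n≡0 c<1))))) 0<j

  -- N_{p³} = ∅: every a + j·p² with a ∈ A_{p²} and j < p lies in A_{p³}.
  N-cube : ∀ b → N p 3 b ⇔ ⊥
  N-cube b = mk⇔ (λ (b∈lift , b∉A) → b∉A (lift-in-A b∈lift)) ⊥-elim
    where
    lift-in-A : Lift (p ^ 2) p b → A (p ^ 3) b
    lift-in-A b∈lift@(a , j , a∈A , j<p , refl) with to (A-split 0 a) a∈A
    ... | inj₁ (_ , p∤a) = from (A-split 1 _) (inj₁ (lift-bound b∈lift , p∤b))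
      where
      p∤b : ¬ p ∣ a + j * p ^ 2
      p∤b p∣b = p∤a (∣m+n∣m⇒∣n (subst (p ∣_) (+-comm a (j * p ^ 2)) p∣b) (∣n⇒∣m*n j (m∣m*n (p ^ 1))))
    ... | inj₂ (zero , _ , refl) =
      from (A-split 1 _) (inj₂ (j , to (A-prime j) j<p , cong (λ t → j * (p * t)) (*-identityʳ p)))
    ... | inj₂ (suc _ , (s≤s () , _) , _)

proposition3p2 : (p : ℕ) → Prime p → p % 4 ≡ 3 →
    ((∀ b → N p 2 b ⇔ (∃[ j ] (0 < j × j < p × b ≡ j * p)))
    × (∀ b → N p 3 b ⇔ ⊥))
    × (∀ n → 2 ≤ n → ∀ k → α≡ (p ^ (n ∸ 1)) k →
        ((n % 2 ≡ 1 → α≡ (p ^ n) (p * k))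
        × (n % 2 ≡ 0 → α≡ (p ^ n) (p * k ∸ p + 1))))
    × (∀ n → 2 ≤ n → ∃[ a ] (α≡ (p ^ n) a
        × (n % 2 ≡ 1 → (p + 1) * a ≡ p * (p ^ n + 1))
        × (n % 2 ≡ 0 → (p + 1) * a ≡ p ^ (n + 1) + 1)))
proposition3p2 p p-prime p≡3 =
  (N-square , N-cube) , recurrence , λ n _ → alpha p n , card-A n , alpha-closed-form p n
  where
  open PrimeThreeModFour p-prime p≡3

  -- the given count k of A_{p^m} is alpha p m, so the recurrence for alpha applies
  recurrence : ∀ n → 2 ≤ n → ∀ k → α≡ (p ^ (n ∸ 1)) k →
               (n % 2 ≡ 1 → α≡ (p ^ n) (p * k)) × (n % 2 ≡ 0 → α≡ (p ^ n) (p * k ∸ p + 1))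
  recurrence (suc m) _ k αₘ≡k with card-unique (card-A m) αₘ≡k
  ... | refl = (λ odd → subst (α≡ (p ^ suc m)) (proj₁ (alpha-recurrence p m) odd) (card-A (suc m)))
             , (λ even → subst (α≡ (p ^ suc m)) (proj₂ (alpha-recurrence p m) even) (card-A (suc m)))
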